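{- Let $\mathcal{C}$ be a sum closed permutation class, and let $f_n=|\mathcal{C}_n|$, $g_n=|\mathcal{C}^{\mathrm{ind}}_n|$ and $\widetilde f_n=|\oplus\mathcal{C}_n|$, with $f_0=1$. Then for every $n\ge1$: (a) $\widetilde f_n=\sum_{k=1}^n k\,g_k\,f_{n-k}$; (b) $\max\{n g_n,f_n\}\le\widetilde f_n\le n f_n$.
   Context: A permutation class is a set of finite permutations closed under containment; $\mathcal{C}_n=\mathcal{C}\cap S_n$. The sum $\sigma\oplus\tau$ of $\sigma\in S_a$ and $\tau\in S_b$ is the permutation in $S_{a+b}$ equal to $\sigma(i)$ for $i\le a$ and to $a+\tau(i-a)$ for $i>a$. A class is sum closed if it is closed under $\oplus$. A permutation is indecomposable if it is not a sum of two permutations of nonzero size, and $\mathcal{C}^{\mathrm{ind}}_n$ is the set of indecomposable permutations in $\mathcal{C}_n$. For $\pi\in S_n$, $\oplus\pi:\mathbb{Z}\to\mathbb{Z}$ is defined by $\oplus\pi(i+kn)=\pi(i)+kn$ for $i\in[n]$ and $k\in\mathbb{Z}$. The shift is $\Sigma^r\sigma(i)=\sigma(i-r)+r$. We set $\oplus\mathcal{C}_n=\{\Sigma^r(\oplus\pi):\pi\in\mathcal{C}_n,\ r\in\mathbb{Z}\}$. -}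

module Defs where

open import Level using (Level; suc; _⊔_)
open import Data.Nat as ℕ using (ℕ; zero; _+_; _*_; _∸_; _≤_; _<_; NonZero)
open import Data.Fin as Fin using (Fin; toℕ; fromℕ<)
open import Data.Integer as ℤ using (ℤ; +_)
open import Data.Integer.DivMod using (_/ℕ_; _%ℕ_; n%ℕd<d)
open import Data.Product using (Σ; _×_; ∃; _,_; proj₁)
open import Data.List using (List; map; applyUpTo)
open import Data.Nat.ListAction using (sum)
open import Function.Definitions using (Injective)
open import Relation.Binary.PropositionalEquality using (_≡_)
open import Relation.Nullary using (¬_)

-- A permutation of size n, written 0-indexed: an injective (hence bijective)
-- map Fin n → Fin n.  Position i / value v correspond to i+1 / v+1 in the paper.
Perm : ℕ → Set
Perm n = Σ (Fin n → Fin n) (Injective _≡_ _≡_)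

⟦_⟧ : ∀ {n} → Perm n → Fin n → Fin n
⟦ π ⟧ = proj₁ π

_≈ₚ_ : ∀ {n} → Perm n → Perm n → Set
π ≈ₚ ρ = ∀ i → ⟦ π ⟧ i ≡ ⟦ ρ ⟧ i

_≼_ : ∀ {k n} → Perm k → Perm n → Set
_≼_ {k} {n} σ π =
  Σ (Fin k → Fin n) λ e →
    (∀ i j → i Fin.< j → e i Fin.< e j) ×
    (∀ i j → (⟦ σ ⟧ i Fin.< ⟦ σ ⟧ j → ⟦ π ⟧ (e i) Fin.< ⟦ π ⟧ (e j)) ×
             (⟦ π ⟧ (e i) Fin.< ⟦ π ⟧ (e j) → ⟦ σ ⟧ i Fin.< ⟦ σ ⟧ j))

PermSet : (ℓ : Level) → Set (suc ℓ)
PermSet ℓ = ∀ {n} → Perm n → Set ℓ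

IsPermClass : ∀ {ℓ} → PermSet ℓ → Set ℓ
IsPermClass C = ∀ {k n} (σ : Perm k) (π : Perm n) → σ ≼ π → C π → C σ

-- value of σ at position i, as a natural number (0-indexed; junk 0 outside [0,a))
val : ∀ {a} → Perm a → ℕ → ℕ
val {a} σ i with i ℕ.<? a
... | Relation.Nullary.yes i<a = toℕ (⟦ σ ⟧ (fromℕ< i<a))
... | Relation.Nullary.no _ = 0

IsSum : ∀ {a b n} → Perm n → Perm a → Perm b → Set
IsSum {a} {b} {n} ρ σ τ =
  (a + b ≡ n) ×
  (∀ (i : Fin n) → toℕ i < a → toℕ (⟦ ρ ⟧ i) ≡ val σ (toℕ i)) ×
  (∀ (i : Fin n) → a ≤ toℕ i → toℕ (⟦ ρ ⟧ i) ≡ a + val τ (toℕ i ∸ a))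

IsSumClosed : ∀ {ℓ} → PermSet ℓ → Set ℓ
IsSumClosed C = ∀ {a b n} (σ : Perm a) (τ : Perm b) (ρ : Perm n) →
  C σ → C τ → IsSum ρ σ τ → C ρ

Indecomposable : ∀ {n} → Perm n → Set
Indecomposable {n} π =
  ¬ (Σ ℕ λ a → Σ ℕ λ b → Σ (Perm a) λ σ → Σ (Perm b) λ τ →
       (1 ≤ a) × (1 ≤ b) × IsSum π σ τ)

-- ⊕π : ℤ → ℤ, in the paper's 1-indexed convention:
-- ⊕π(i + k n) = π(i) + k n for i ∈ [1,n]; here m = i + k n with
-- i - 1 = (m - 1) mod n and k = (m - 1) div n (Euclidean).
⊕_ : ∀ {n} .{{_ : NonZero n}} → Perm n → ℤ → ℤ
⊕_ {n} π m =
  let m′ = m ℤ.- (+ 1)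
      i  = fromℕ< (n%ℕd<d m′ n)
  in (+ ℕ.suc (toℕ (⟦ π ⟧ i))) ℤ.+ (m′ /ℕ n) ℤ.* (+ n)

shift : ℤ → (ℤ → ℤ) → ℤ → ℤ
shift r σ i = σ (i ℤ.- r) ℤ.+ r

-- cardinality of a type with an equality relation:
-- HasCard A _≈_ m  iff  A / ≈ has exactly m elements
HasCard : ∀ {a r} (A : Set a) → (A → A → Set r) → ℕ → Set (a ⊔ r)
HasCard A _≈_ m =
  Σ (Fin m → A) λ e →
    (∀ i j → e i ≈ e j → i ≡ j) × (∀ x → ∃ λ i → e i ≈ x)

Cₙ : ∀ {ℓ} → PermSet ℓ → ℕ → Set ℓ
Cₙ C n = Σ (Perm n) C

≈C : ∀ {ℓ} (C : PermSet ℓ) {n} → Cₙ C n → Cₙ C n → Set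
≈C C (π , _) (ρ , _) = π ≈ₚ ρ

Cindₙ : ∀ {ℓ} → PermSet ℓ → ℕ → Set ℓ
Cindₙ C n = Σ (Perm n) λ π → C π × Indecomposable π

≈I : ∀ {ℓ} (C : PermSet ℓ) {n} → Cindₙ C n → Cindₙ C n → Set
≈I C (π , _) (ρ , _) = π ≈ₚ ρ

-- ⊕𝒞ₙ = { Σ^r(⊕π) : π ∈ 𝒞ₙ, r ∈ ℤ }, as index pairs (π , r) identified when
-- the resulting functions ℤ → ℤ are equal (pointwise)
⊕Cₙ : ∀ {ℓ} → PermSet ℓ → ℕ → Set ℓ
⊕Cₙ C n = Cₙ C n × ℤ

⊕≈ : ∀ {ℓ} (C : PermSet ℓ) (n : ℕ) .{{_ : NonZero n}} → ⊕Cₙ C n → ⊕Cₙ C n → Set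
⊕≈ C n ((π , _) , r) ((ρ , _) , s) = ∀ m → shift r (⊕ π) m ≡ shift s (⊕ ρ) m

∑[1‥_] : ℕ → (ℕ → ℕ) → ℕ
∑[1‥ n ] h = sum (map h (applyUpTo ℕ.suc n))

-- A nonempty π splits as β ⊕ α with α indecomposable, cutting at its greatest split point; the
-- cut is unique, since any split point inside α would decompose α.  As the class is closed under
-- ⊕ and under taking summands, (k , α , β) ↦ β ⊕ α is a bijection from the triples with
-- α ∈ 𝒞ᵏ^ind and β ∈ 𝒞_{n−k} onto 𝒞ₙ, so fₙ = Σₖ gₖ fₙ₋ₖ.
--
-- Σ^r(⊕π) depends only on r mod n, and Σ^r ⊕(β ⊕ α) = Σ^{r+|β|} ⊕(α ⊕ β).  Rotating in this way,
-- every element of ⊕𝒞ₙ is Σ^j ⊕(β ⊕ α) with α indecomposable and 0 ≤ j < |α|, and these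
-- representatives are distinct: Σ^j ⊕ρ = Σ^{j′} ⊕ρ′ with j < j′ forces ρ′ to split at
-- n − (j′ − j), strictly inside its last block.  Hence f̃ₙ = Σₖ k gₖ fₙ₋ₖ.  The bounds follow
-- termwise: k gₖ fₙ₋ₖ lies between gₖ fₙ₋ₖ and n gₖ fₙ₋ₖ, and the last term is n gₙ f₀ = n gₙ.

module Submission where

open import Defs

module Permutation where

  open import Data.Nat using (ℕ; zero; suc; _+_; _∸_; _≤_; _<_; z≤n; s≤s; z<s; _<?_; _≤?_)
  open import Data.Nat.Properties
  open import Data.Fin as Fin using (Fin; toℕ; fromℕ<)
  import Data.Fin.Properties as Finₚ
  open import Data.Product using (Σ; ∃-syntax; _×_; _,_; proj₁; proj₂)
  open import Relation.Nullary using (Dec; yes; no; ¬_; contradiction)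
  open import Relation.Nullary.Decidable using (map′; _×-dec_; _→-dec_)
  open import Relation.Binary.PropositionalEquality
  open import Relation.Binary.Definitions using (tri<; tri≈; tri>)
  open import Data.Sum using (inj₁; inj₂)
  open import Data.Empty using (⊥-elim)
  open import Function using (id)

  val-fromℕ< : ∀ {a} (σ : Perm a) {i} (i<a : i < a) → val σ i ≡ toℕ (⟦ σ ⟧ (fromℕ< i<a))
  val-fromℕ< {a} σ {i} i<a with i <? a
  ... | yes i<a′ = cong (λ x → toℕ (⟦ σ ⟧ x)) (Finₚ.fromℕ<-cong i i refl i<a′ i<a)
  ... | no i≮a = contradiction i<a i≮a

  val-toℕ : ∀ {a} (σ : Perm a) (x : Fin a) → val σ (toℕ x) ≡ toℕ (⟦ σ ⟧ x)
  val-toℕ σ x = trans (val-fromℕ< σ (Finₚ.toℕ<n x)) (cong (λ y → toℕ (⟦ σ ⟧ y)) (Finₚ.fromℕ<-toℕ x _))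

  val< : ∀ {a} (σ : Perm a) {i} → i < a → val σ i < a
  val< σ i<a = subst (_< _) (sym (val-fromℕ< σ i<a)) (Finₚ.toℕ<n _)

  val-injective : ∀ {a} (σ : Perm a) {i j} → i < a → j < a → val σ i ≡ val σ j → i ≡ j
  val-injective σ {i} {j} i<a j<a eq = begin
    i                   ≡⟨ Finₚ.toℕ-fromℕ< i<a ⟨
    toℕ (fromℕ< i<a)    ≡⟨ cong toℕ (proj₂ σ (Finₚ.toℕ-injective ⟦σ⟧-eq)) ⟩
    toℕ (fromℕ< j<a)    ≡⟨ Finₚ.toℕ-fromℕ< j<a ⟩
    j                   ∎
    where
    open ≡-Reasoning
    ⟦σ⟧-eq = trans (sym (val-fromℕ< σ i<a)) (trans eq (val-fromℕ< σ j<a))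

  fromVal : ∀ n (h : ℕ → ℕ) → (∀ {i} → i < n → h i < n) →
            (∀ {i j} → i < n → j < n → h i ≡ h j → i ≡ j) → Perm n
  fromVal n h h<n h-inj = (λ x → fromℕ< (h<n (Finₚ.toℕ<n x))) , λ {x} {y} eq →
    Finₚ.toℕ-injective (h-inj (Finₚ.toℕ<n x) (Finₚ.toℕ<n y)
      (trans (sym (Finₚ.toℕ-fromℕ< _)) (trans (cong toℕ eq) (Finₚ.toℕ-fromℕ< _))))

  val-fromVal : ∀ {n h} (h<n : ∀ {i} → i < n → h i < n)
                (h-inj : ∀ {i j} → i < n → j < n → h i ≡ h j → i ≡ j) →
                ∀ {i} → i < n → val (fromVal n h h<n h-inj) i ≡ h i
  val-fromVal {n} {h} h<n h-inj i<n = trans (val-fromℕ< (fromVal n h h<n h-inj) i<n)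
    (trans (Finₚ.toℕ-fromℕ< _) (cong h (Finₚ.toℕ-fromℕ< i<n)))

  _≈ᵥ_ : ∀ {n} → Perm n → Perm n → Set
  _≈ᵥ_ {n} π ρ = ∀ {i} → i < n → val π i ≡ val ρ i

  ≈ᵥ⇒≈ₚ : ∀ {n} {π ρ : Perm n} → π ≈ᵥ ρ → π ≈ₚ ρ
  ≈ᵥ⇒≈ₚ {π = π} {ρ} eq x =
    Finₚ.toℕ-injective (trans (sym (val-toℕ π x)) (trans (eq (Finₚ.toℕ<n x)) (val-toℕ ρ x)))

  ≈ₚ⇒≈ᵥ : ∀ {n} {π ρ : Perm n} → π ≈ₚ ρ → π ≈ᵥ ρ
  ≈ₚ⇒≈ᵥ {π = π} {ρ} eq i<n = trans (val-fromℕ< π i<n) (trans (cong toℕ (eq _)) (sym (val-fromℕ< ρ i<n)))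

  <+⇒∸< : ∀ {a b i} → a ≤ i → i < a + b → i ∸ a < b
  <+⇒∸< {a} {b} a≤i i<a+b = +-cancelˡ-< a _ b (subst (_< a + b) (sym (m+[n∸m]≡n a≤i)) i<a+b)

  IsSum-fromVal : ∀ {a b n} (ρ : Perm n) (σ : Perm a) (τ : Perm b) → a + b ≡ n →
    (∀ {i} → i < a → val ρ i ≡ val σ i) → (∀ {i} → a ≤ i → i < n → val ρ i ≡ a + val τ (i ∸ a)) →
    IsSum ρ σ τ
  IsSum-fromVal ρ σ τ a+b≡n left right = a+b≡n ,
    (λ x x<a → trans (sym (val-toℕ ρ x)) (left x<a)) ,
    (λ x a≤x → trans (sym (val-toℕ ρ x)) (right a≤x (Finₚ.toℕ<n x)))

  SplitsAt : ∀ {n} → Perm n → ℕ → Set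
  SplitsAt {n} π p = ∀ {i} → i < n → (i < p → val π i < p) × (p ≤ i → p ≤ val π i)

  SplitsAt? : ∀ {n} (π : Perm n) p → Dec (SplitsAt π p)
  SplitsAt? {n} π p = map′ fromFin toFin (Finₚ.all? λ x → splits? (toℕ x))
    where
    splits? : ∀ i → Dec ((i < p → val π i < p) × (p ≤ i → p ≤ val π i))
    splits? i = (i <? p →-dec val π i <? p) ×-dec (p ≤? i →-dec p ≤? val π i)
    fromFin : _ → SplitsAt π p
    fromFin h i<n = subst (λ i → (i < p → val π i < p) × (p ≤ i → p ≤ val π i))
                          (Finₚ.toℕ-fromℕ< i<n) (h (fromℕ< i<n))
    toFin : SplitsAt π p → _
    toFin h x = h (Finₚ.toℕ<n x)

  module _ {n} (π : Perm n) {p q} (p+q≡n : p + q ≡ n) (split : SplitsAt π p) where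

    private
      p≤n : p ≤ n
      p≤n = subst (p ≤_) p+q≡n (m≤m+n p q)

      <n⇒∸<q : ∀ {i} → p ≤ i → i < n → i ∸ p < q
      <n⇒∸<q p≤i i<n = <+⇒∸< p≤i (subst (_ <_) (sym p+q≡n) i<n)

      p+<n : ∀ {i} → i < q → p + i < n
      p+<n i<q = subst (_ <_) p+q≡n (+-monoʳ-< p i<q)

      p≤val : ∀ {i} → i < q → p ≤ val π (p + i)
      p≤val i<q = proj₂ (split (p+<n i<q)) (m≤m+n p _)

      upperVal : ℕ → ℕ
      upperVal i = val π (p + i) ∸ p

      lower< : ∀ {i} → i < p → val π i < p
      lower< i<p = proj₁ (split (<-≤-trans i<p p≤n)) i<p

      lower-injective : ∀ {i j} → i < p → j < p → val π i ≡ val π j → i ≡ j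
      lower-injective i<p j<p = val-injective π (<-≤-trans i<p p≤n) (<-≤-trans j<p p≤n)

      upper< : ∀ {i} → i < q → upperVal i < q
      upper< i<q = <n⇒∸<q (p≤val i<q) (val< π (p+<n i<q))

      upper-injective : ∀ {i j} → i < q → j < q → upperVal i ≡ upperVal j → i ≡ j
      upper-injective i<q j<q eq = +-cancelˡ-≡ p _ _ (val-injective π (p+<n i<q) (p+<n j<q)
        (∸-cancelʳ-≡ (p≤val i<q) (p≤val j<q) eq))

    lowerPart : Perm p
    lowerPart = fromVal p (val π) lower< lower-injective

    upperPart : Perm q
    upperPart = fromVal q upperVal upper< upper-injective

    IsSum-parts : IsSum π lowerPart upperPart
    IsSum-parts = IsSum-fromVal π lowerPart upperPart p+q≡n
      (λ i<p → sym (val-fromVal lower< lower-injective i<p))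
      (λ {i} p≤i i<n → sym (begin
        p + val upperPart (i ∸ p)      ≡⟨ cong (p +_) (val-fromVal upper< upper-injective (<n⇒∸<q p≤i i<n)) ⟩
        p + (val π (p + (i ∸ p)) ∸ p)  ≡⟨ cong (λ j → p + (val π j ∸ p)) (m+[n∸m]≡n p≤i) ⟩
        p + (val π i ∸ p)              ≡⟨ m+[n∸m]≡n (proj₂ (split i<n) p≤i) ⟩
        val π i                        ∎))
      where open ≡-Reasoning

  -- IsSum ρ σ τ unfolds to a Σ-type that mentions ρ only through ⟦ ρ ⟧ and σ, τ only through val, so
  -- these arguments cannot be inferred from a proof of IsSum and are given explicitly when the goal
  -- does not fix them.
  module _ {a b n} {ρ : Perm n} {σ : Perm a} {τ : Perm b} (s : IsSum ρ σ τ) where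

    IsSum-≤ : a ≤ n
    IsSum-≤ = subst (a ≤_) (proj₁ s) (m≤m+n a b)

    IsSum-left : ∀ {i} → i < a → val ρ i ≡ val σ i
    IsSum-left i<a = trans (val-fromℕ< ρ i<n)
      (trans (proj₁ (proj₂ s) _ (subst (_< a) (sym (Finₚ.toℕ-fromℕ< i<n)) i<a))
             (cong (val σ) (Finₚ.toℕ-fromℕ< i<n)))
      where i<n = <-≤-trans i<a IsSum-≤

    IsSum-right : ∀ {i} → a ≤ i → i < n → val ρ i ≡ a + val τ (i ∸ a)
    IsSum-right a≤i i<n = trans (val-fromℕ< ρ i<n)
      (trans (proj₂ (proj₂ s) _ (subst (a ≤_) (sym (Finₚ.toℕ-fromℕ< i<n)) a≤i))
             (cong (λ x → a + val τ (x ∸ a)) (Finₚ.toℕ-fromℕ< i<n)))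

    IsSum-+< : ∀ {i} → i < b → a + i < n
    IsSum-+< i<b = subst (_ <_) (proj₁ s) (+-monoʳ-< a i<b)

    IsSum-right′ : ∀ {i} → i < b → val ρ (a + i) ≡ a + val τ i
    IsSum-right′ {i} i<b = trans (IsSum-right (m≤m+n a i) (IsSum-+< i<b)) (cong (λ x → a + val τ x) (m+n∸m≡n a i))

    IsSum⇒SplitsAt : SplitsAt ρ a
    IsSum⇒SplitsAt i<n =
      (λ i<a → subst (_< a) (sym (IsSum-left i<a)) (val< σ i<a)) ,
      (λ a≤i → subst (a ≤_) (sym (IsSum-right a≤i i<n)) (m≤m+n a _))

    SplitsAt-in-summandʳ : ∀ {m} → a ≤ m → SplitsAt ρ m → SplitsAt τ (m ∸ a)
    SplitsAt-in-summandʳ {m} a≤m split {i} i<b =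
      (λ i<m∸a → +-cancelˡ-< a _ _ (subst₂ _<_ (IsSum-right′ i<b) (sym a+[m∸a]≡m)
         (proj₁ (split (IsSum-+< i<b)) (subst (a + i <_) a+[m∸a]≡m (+-monoʳ-< a i<m∸a))))) ,
      (λ m∸a≤i → +-cancelˡ-≤ a _ _ (subst₂ _≤_ (sym a+[m∸a]≡m) (IsSum-right′ i<b)
         (proj₂ (split (IsSum-+< i<b)) (subst (_≤ a + i) a+[m∸a]≡m (+-monoʳ-≤ a m∸a≤i)))))
      where a+[m∸a]≡m = m+[n∸m]≡n a≤m

    splitInside-decomposes : Indecomposable τ → ∀ {m} → a < m → m < n → ¬ SplitsAt ρ m
    splitInside-decomposes indec {m} a<m m<n split = indec
      (m ∸ a , b ∸ (m ∸ a) , _ , _ , m<n⇒0<n∸m a<m , m<n⇒0<n∸m m∸a<b ,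
       IsSum-parts τ (m+[n∸m]≡n (<⇒≤ m∸a<b)) splitτ)
      where
      m∸a<b : m ∸ a < b
      m∸a<b = <+⇒∸< (<⇒≤ a<m) (subst (m <_) (sym (proj₁ s)) m<n)
      splitτ = SplitsAt-in-summandʳ (<⇒≤ a<m) split

  module _ {a b n} {ρ : Perm n} {σ σ′ : Perm a} {τ τ′ : Perm b} (s : IsSum ρ σ τ) (s′ : IsSum ρ σ′ τ′) where

    IsSum-injectiveˡ : σ ≈ᵥ σ′
    IsSum-injectiveˡ i<a = trans (sym (IsSum-left {ρ = ρ} {τ = τ} s i<a)) (IsSum-left {ρ = ρ} {τ = τ′} s′ i<a)

    IsSum-injectiveʳ : τ ≈ᵥ τ′
    IsSum-injectiveʳ i<b = +-cancelˡ-≡ a _ _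
      (trans (sym (IsSum-right′ {ρ = ρ} {σ = σ} s i<b)) (IsSum-right′ {ρ = ρ} {σ = σ′} s′ i<b))

  IsSum-cong : ∀ {a b n} {ρ ρ′ : Perm n} {σ σ′ : Perm a} {τ τ′ : Perm b} →
    IsSum ρ σ τ → IsSum ρ′ σ′ τ′ → σ ≈ᵥ σ′ → τ ≈ᵥ τ′ → ρ ≈ᵥ ρ′
  IsSum-cong {a} {b} {σ = σ} {σ′} {τ} {τ′} s s′ σ≈σ′ τ≈τ′ {i} i<n with i <? a
  ... | yes i<a = trans (IsSum-left s i<a) (trans (σ≈σ′ i<a) (sym (IsSum-left s′ i<a)))
  ... | no i≮a = trans (IsSum-right s a≤i i<n)
    (trans (cong (a +_) (τ≈τ′ (<+⇒∸< a≤i (subst (i <_) (sym (proj₁ s)) i<n)))) (sym (IsSum-right s′ a≤i i<n)))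
    where a≤i = ≮⇒≥ i≮a

  IsSum-resp-≈ᵥ : ∀ {a b n} {ρ ρ′ : Perm n} {σ : Perm a} {τ : Perm b} → ρ ≈ᵥ ρ′ → IsSum ρ σ τ → IsSum ρ′ σ τ
  IsSum-resp-≈ᵥ {a} {b} {ρ′ = ρ′} {σ} {τ} eq s = IsSum-fromVal ρ′ σ τ (proj₁ s)
    (λ i<a → trans (sym (eq (<-≤-trans i<a (subst (a ≤_) (proj₁ s) (m≤m+n a b))))) (IsSum-left s i<a))
    (λ a≤i i<n → trans (sym (eq i<n)) (IsSum-right s a≤i i<n))

  module _ {a b} (σ : Perm a) (τ : Perm b) where

    sumVal : ℕ → ℕ
    sumVal i with i <? a
    ... | yes _ = val σ i
    ... | no _ = a + val τ (i ∸ a)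

    sumVal-< : ∀ {i} → i < a → sumVal i ≡ val σ i
    sumVal-< {i} i<a with i <? a
    ... | yes i<a′ = val-fromℕ< σ i<a′
    ... | no i≮a = contradiction i<a i≮a

    sumVal-≥ : ∀ {i} → a ≤ i → sumVal i ≡ a + val τ (i ∸ a)
    sumVal-≥ {i} a≤i with i <? a
    ... | yes i<a = contradiction a≤i (<⇒≱ i<a)
    ... | no _ = refl

    sumVal< : ∀ {i} → i < a + b → sumVal i < a + b
    sumVal< {i} i<n with i <? a
    ... | yes i<a = <-≤-trans (val< σ i<a) (m≤m+n a b)
    ... | no i≮a = +-monoʳ-< a (val< τ (<+⇒∸< (≮⇒≥ i≮a) i<n))

    sumVal-injective : ∀ {i j} → i < a + b → j < a + b → sumVal i ≡ sumVal j → i ≡ j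
    sumVal-injective {i} {j} i<n j<n eq with i <? a | j <? a
    ... | yes i<a | yes j<a = val-injective σ i<a j<a eq
    ... | yes i<a | no _ = contradiction (subst (_< a) eq (val< σ i<a)) (λ lt → <⇒≱ lt (m≤m+n a _))
    ... | no _ | yes j<a = contradiction (subst (_< a) (sym eq) (val< σ j<a)) (λ lt → <⇒≱ lt (m≤m+n a _))
    ... | no i≮a | no j≮a = ∸-cancelʳ-≡ (≮⇒≥ i≮a) (≮⇒≥ j≮a)
      (val-injective τ (<+⇒∸< (≮⇒≥ i≮a) i<n) (<+⇒∸< (≮⇒≥ j≮a) j<n) (+-cancelˡ-≡ a _ _ eq))

  module _ {a b n} (a+b≡n : a + b ≡ n) (σ : Perm a) (τ : Perm b) where

    private
      <a+b : ∀ {i} → i < n → i < a + b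
      <a+b = subst (_ <_) (sym a+b≡n)

      sumVal<n : ∀ {i} → i < n → sumVal σ τ i < n
      sumVal<n i<n = subst (_ <_) a+b≡n (sumVal< σ τ (<a+b i<n))

      sumVal-injective′ : ∀ {i j} → i < n → j < n → sumVal σ τ i ≡ sumVal σ τ j → i ≡ j
      sumVal-injective′ i<n j<n = sumVal-injective σ τ (<a+b i<n) (<a+b j<n)

    directSum : Perm n
    directSum = fromVal n (sumVal σ τ) sumVal<n sumVal-injective′

    directSum-IsSum : IsSum directSum σ τ
    directSum-IsSum = IsSum-fromVal directSum σ τ a+b≡n
      (λ i<a → trans (val-fromVal sumVal<n sumVal-injective′ (<-≤-trans i<a (subst (a ≤_) a+b≡n (m≤m+n a b))))
                     (sumVal-< σ τ i<a))
      (λ a≤i i<n → trans (val-fromVal sumVal<n sumVal-injective′ i<n) (sumVal-≥ σ τ a≤i))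

  greatestBelow : {P : ℕ → Set} → (∀ m → Dec (P m)) → P 0 → ∀ n →
    ∃[ p ] p ≤ n × P p × (∀ {m} → p < m → m ≤ n → ¬ P m)
  greatestBelow P? P0 zero = 0 , z≤n , P0 , λ 0<m m≤0 _ → <⇒≱ 0<m m≤0
  greatestBelow P? P0 (suc n) with P? (suc n) | greatestBelow P? P0 n
  ... | yes Psn | _ = suc n , ≤-refl , Psn , λ sn<m m≤sn _ → <⇒≱ sn<m m≤sn
  ... | no ¬Psn | p , p≤n , Pp , maximal = p , m≤n⇒m≤1+n p≤n , Pp , above
    where
    above : ∀ {m} → p < m → m ≤ suc n → ¬ _
    above p<m m≤sn with m≤n⇒m<n∨m≡n m≤sn
    ... | inj₁ m<sn = maximal p<m (≤-pred m<sn)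
    ... | inj₂ refl = ¬Psn

  SplitsAt-0 : ∀ {n} (π : Perm n) → SplitsAt π 0
  SplitsAt-0 π _ = (λ ()) , (λ _ → z≤n)

  SplitsAt-⊕ʳ : ∀ {a b n} {ρ : Perm n} {σ : Perm a} {τ : Perm b} → IsSum ρ σ τ →
    ∀ {m} → SplitsAt τ m → SplitsAt ρ (a + m)
  SplitsAt-⊕ʳ {a} {b} {ρ = ρ} {σ} {τ} s {m} split {i} i<n with i <? a
  ... | yes i<a = (λ _ → <-≤-trans (subst (_< a) (sym (IsSum-left s i<a)) (val< σ i<a)) (m≤m+n a m)) ,
                  (λ a+m≤i → contradiction (≤-trans (m≤m+n a m) a+m≤i) (<⇒≱ i<a))
  ... | no i≮a = (λ i<a+m → subst (_< a + m) (sym vρ) (+-monoʳ-< a (proj₁ (split i∸a<b) (<+⇒∸< a≤i i<a+m)))) ,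
                 (λ a+m≤i → subst (a + m ≤_) (sym vρ) (+-monoʳ-≤ a (proj₂ (split i∸a<b)
                               (subst (_≤ i ∸ a) (m+n∸m≡n a m) (∸-monoˡ-≤ a a+m≤i)))))
    where
    a≤i = ≮⇒≥ i≮a
    i∸a<b = <+⇒∸< a≤i (subst (i <_) (sym (proj₁ s)) i<n)
    vρ = IsSum-right s a≤i i<n

  record LastBlock {n} (π : Perm n) : Set where
    field
      {start size} : ℕ
      rest : Perm start
      block : Perm (suc size)
      isSum : IsSum π rest block
      indecomposable : Indecomposable block

    size<n : size < n
    size<n = subst (size <_) (trans (sym (+-suc start size)) (proj₁ isSum)) (s≤s (m≤n+m size start))

  lastBlock : ∀ {m} (π : Perm (suc m)) → LastBlock π
  lastBlock {m} π with greatestBelow (SplitsAt? π) (SplitsAt-0 π) m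
  ... | p , p≤m , split , maximal = record
    { rest = lowerPart π p+k≡n split ; block = upperPart π p+k≡n split
    ; isSum = IsSum-parts π p+k≡n split ; indecomposable = indecomposable }
    where
    p+k≡n : p + suc (m ∸ p) ≡ suc m
    p+k≡n = trans (+-suc p (m ∸ p)) (cong suc (m+[n∸m]≡n p≤m))
    indecomposable : Indecomposable (upperPart π p+k≡n split)
    indecomposable (a , b , σ , τ , 1≤a , 1≤b , s) = maximal p<p+a (≤-pred p+a<n)
      (SplitsAt-⊕ʳ (IsSum-parts π p+k≡n split) (IsSum⇒SplitsAt s))
      where
      p<p+a : p < p + a
      p<p+a = m<m+n p 1≤a
      p+a<n : p + a < suc m
      p+a<n = subst (p + a <_) p+k≡n (+-monoʳ-< p (subst (a <_) (proj₁ s) (m<m+n a 1≤b)))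

  IsSum-< : ∀ {p k n} {ρ : Perm n} {σ : Perm p} {τ : Perm (suc k)} → IsSum ρ σ τ → p < n
  IsSum-< {p} s = subst (p <_) (proj₁ s) (m<m+n p z<s)

  lastBlock-unique : ∀ {n p p′ k k′} {π : Perm n} {β : Perm p} {α : Perm (suc k)} {β′ : Perm p′} {α′ : Perm (suc k′)} →
    IsSum π β α → Indecomposable α → IsSum π β′ α′ → Indecomposable α′ → p ≡ p′
  lastBlock-unique {p = p} {p′} {π = π} s indec s′ indec′ with <-cmp p p′
  ... | tri≈ _ p≡p′ _ = p≡p′
  ... | tri< p<p′ _ _ =
    ⊥-elim (splitInside-decomposes {ρ = π} s indec p<p′ (IsSum-< {ρ = π} s′) (IsSum⇒SplitsAt {ρ = π} s′))
  ... | tri> _ _ p′<p =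
    ⊥-elim (splitInside-decomposes {ρ = π} s′ indec′ p′<p (IsSum-< {ρ = π} s) (IsSum⇒SplitsAt {ρ = π} s))

  ≼-fromShiftedCopy : ∀ {k n} (σ : Perm k) (π : Perm n) c (h : ℕ → ℕ) →
    (∀ {i} → i < k → h i < n) → (∀ {i j} → i < j → h i < h j) →
    (∀ {i} → i < k → val π (h i) ≡ c + val σ i) → σ ≼ π
  ≼-fromShiftedCopy {k} {n} σ π c h h<n h-mono copy = e , e-mono , λ i j →
    (λ σi<σj → subst₂ _<_ (sym (π∘e i)) (sym (π∘e j)) (+-monoʳ-< c σi<σj)) ,
    (λ πi<πj → +-cancelˡ-< c _ _ (subst₂ _<_ (π∘e i) (π∘e j) πi<πj))
    where
    e : Fin k → Fin n
    e x = fromℕ< (h<n (Finₚ.toℕ<n x))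
    e-mono : ∀ x y → x Fin.< y → e x Fin.< e y
    e-mono x y x<y = subst₂ _<_ (sym (Finₚ.toℕ-fromℕ< _)) (sym (Finₚ.toℕ-fromℕ< _)) (h-mono x<y)
    π∘e : ∀ x → toℕ (⟦ π ⟧ (e x)) ≡ c + toℕ (⟦ σ ⟧ x)
    π∘e x = begin
      toℕ (⟦ π ⟧ (e x))        ≡⟨ val-toℕ π (e x) ⟨
      val π (toℕ (e x))        ≡⟨ cong (val π) (Finₚ.toℕ-fromℕ< _) ⟩
      val π (h (toℕ x))        ≡⟨ copy (Finₚ.toℕ<n x) ⟩
      c + val σ (toℕ x)        ≡⟨ cong (c +_) (val-toℕ σ x) ⟩
      c + toℕ (⟦ σ ⟧ x)        ∎
      where open ≡-Reasoning

  εₚ : Perm 0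
  εₚ = (λ ()) , λ { {()} }

  module _ {ℓ} {C : PermSet ℓ} (closed : IsPermClass C) where

    empty-∈ : ∀ {k} {α : Perm k} → C α → C εₚ
    empty-∈ {α = α} = closed εₚ α (≼-fromShiftedCopy εₚ α 0 id (λ ()) id λ ())

    module _ {a b n} {ρ : Perm n} {σ : Perm a} {τ : Perm b} (s : IsSum ρ σ τ) where

      summandˡ-∈ : C ρ → C σ
      summandˡ-∈ = closed σ ρ (≼-fromShiftedCopy σ ρ 0 id
        (λ i<a → <-≤-trans i<a (IsSum-≤ {ρ = ρ} {σ = σ} {τ = τ} s)) id (IsSum-left s))

      summandʳ-∈ : C ρ → C τ
      summandʳ-∈ = closed τ ρ (≼-fromShiftedCopy τ ρ a (a +_)
        (IsSum-+< {ρ = ρ} {σ = σ} {τ = τ} s) (+-monoʳ-< a) (IsSum-right′ s))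

module PeriodicExtension where

  open Permutation
  open import Data.Nat as ℕ using (ℕ; zero; suc; NonZero)
  import Data.Nat.Properties as ℕ
  open import Data.Integer using (ℤ; +_; -[1+_]; _+_; _*_; _-_; -_)
  import Data.Integer.Properties as ℤ
  open import Data.Integer.DivMod using (_/ℕ_; _%ℕ_; n%ℕd<d; a≡a%ℕn+[a/ℕn]*n)
  open import Data.Integer.Tactic.RingSolver using (solve-∀)
  open import Data.Fin using (toℕ)
  open import Data.Product using (Σ; ∃-syntax; _×_; _,_; proj₁; proj₂)
  open import Data.Empty using (⊥-elim)
  open import Relation.Nullary using (¬_; yes; no)
  open import Relation.Binary.PropositionalEquality

  private
    quotientGap : ∀ {n r r′} t t′ → + r + t * + n ≡ + r′ + t′ * + n → + r ≡ + r′ + (t′ - t) * + n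
    quotientGap {n} {r} {r′} t t′ eq = begin
      + r                          ≡⟨ cancel (+ r) t (+ n) ⟩
      (+ r + t * + n) - t * + n    ≡⟨ cong (_- t * + n) eq ⟩
      (+ r′ + t′ * + n) - t * + n  ≡⟨ regroup (+ r′) t t′ (+ n) ⟩
      + r′ + (t′ - t) * + n        ∎
      where
      open ≡-Reasoning
      cancel : ∀ a b m → a ≡ (a + b * m) - b * m
      cancel = solve-∀
      regroup : ∀ a b c m → (a + c * m) - b * m ≡ a + (c - b) * m
      regroup = solve-∀

    sub-swap : ∀ a b → a - b ≡ - (b - a)
    sub-swap = solve-∀

    sub-add-cancel : ∀ a b → b ≡ (b - a) + a
    sub-add-cancel = solve-∀

    remainder-no-wrap : ∀ {n r r′} k → r ℕ.< n → ¬ (+ r ≡ + r′ + + suc k * + n)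
    remainder-no-wrap {n} {r} {r′} k r<n eq = ℕ.<⇒≱ r<n (begin
      n                   ≤⟨ ℕ.m≤m+n n (k ℕ.* n) ⟩
      suc k ℕ.* n         ≤⟨ ℕ.m≤n+m (suc k ℕ.* n) r′ ⟩
      r′ ℕ.+ suc k ℕ.* n  ≡⟨ ℤ.+-injective (sym (trans eq pos)) ⟩
      r                   ∎)
      where
      open ℕ.≤-Reasoning
      pos = trans (cong (_+_ (+ r′)) (sym (ℤ.pos-* (suc k) n))) (sym (ℤ.pos-+ r′ _))

  divMod-unique : ∀ {n r r′} (t t′ : ℤ) → r ℕ.< n → r′ ℕ.< n →
    + r + t * + n ≡ + r′ + t′ * + n → r ≡ r′ × t ≡ t′
  divMod-unique {n} {r} {r′} t t′ r<n r′<n eq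
    with t′ - t | quotientGap t t′ eq | quotientGap t′ t (sym eq) | sub-swap t t′ | sub-add-cancel t t′
  ... | + zero | r≡ | _ | _ | t′≡ = ℤ.+-injective (trans r≡ (ℤ.+-identityʳ _)) , sym (trans t′≡ (ℤ.+-identityˡ t))
  ... | + suc k | r≡ | _ | _ | _ = ⊥-elim (remainder-no-wrap k r<n r≡)
  ... | -[1+ k ] | _ | r′≡ | t-t′≡ | _ =
    ⊥-elim (remainder-no-wrap k r′<n (subst (λ d → + r′ ≡ + r + d * + n) t-t′≡ r′≡))

  module _ {n} .{{_ : NonZero n}} where

    euclid : ∀ x → ∃[ i ] ∃[ t ] i ℕ.< n × x ≡ + suc i + t * + n
    euclid x = x′ %ℕ n , x′ /ℕ n , n%ℕd<d x′ n ,
      trans (add1 x) (trans (cong (_+_ (+ 1)) (a≡a%ℕn+[a/ℕn]*n x′ n))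
                            (sym (ℤ.+-assoc (+ 1) (+ (x′ %ℕ n)) (x′ /ℕ n * + n))))
      where
      x′ = x - + 1
      add1 : ∀ a → a ≡ + 1 + (a - + 1)
      add1 = solve-∀

    ⊕-eval : ∀ (π : Perm n) {i} (t : ℤ) → i ℕ.< n → (⊕ π) (+ suc i + t * + n) ≡ + suc (val π i) + t * + n
    ⊕-eval π {i} t i<n = cong₂ (λ j q → + suc j + q * + n)
      (trans (sym (val-fromℕ< π (n%ℕd<d x n))) (cong (val π) (proj₁ unique)))
      (proj₂ unique)
      where
      x = (+ suc i + t * + n) - + 1
      x≡ : x ≡ + i + t * + n
      x≡ = drop1 (+ i) (t * + n)
        where
        drop1 : ∀ a b → ((+ 1 + a) + b) - + 1 ≡ a + b
        drop1 = solve-∀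
      unique = divMod-unique (x /ℕ n) t (n%ℕd<d x n) i<n (trans (sym (a≡a%ℕn+[a/ℕn]*n x n)) x≡)

    ⊕-periodic : ∀ (π : Perm n) y t → (⊕ π) (y + t * + n) ≡ (⊕ π) y + t * + n
    ⊕-periodic π y t with euclid y
    ... | i , s , i<n , refl = begin
      (⊕ π) ((+ suc i + s * + n) + t * + n)  ≡⟨ cong (⊕ π) (assoc (+ suc i) s t (+ n)) ⟩
      (⊕ π) (+ suc i + (s + t) * + n)        ≡⟨ ⊕-eval π (s + t) i<n ⟩
      + suc (val π i) + (s + t) * + n        ≡⟨ assoc (+ suc (val π i)) s t (+ n) ⟨
      + suc (val π i) + s * + n + t * + n    ≡⟨ cong (_+ t * + n) (⊕-eval π s i<n) ⟨
      (⊕ π) (+ suc i + s * + n) + t * + n    ∎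
      where
      open ≡-Reasoning
      assoc : ∀ a b c m → (a + b * m) + c * m ≡ a + (b + c) * m
      assoc = solve-∀

    shift-periodic : ∀ (π : Perm n) r t x → shift (r + t * + n) (⊕ π) x ≡ shift r (⊕ π) x
    shift-periodic π r t x = begin
      (⊕ π) (x - (r + t * + n)) + (r + t * + n)    ≡⟨ cong (λ y → (⊕ π) y + (r + t * + n)) (split x r t (+ n)) ⟩
      (⊕ π) ((x - r) + (- t) * + n) + (r + t * + n) ≡⟨ cong (_+ (r + t * + n)) (⊕-periodic π (x - r) (- t)) ⟩
      ((⊕ π) (x - r) + (- t) * + n) + (r + t * + n) ≡⟨ cancel ((⊕ π) (x - r)) r t (+ n) ⟩
      (⊕ π) (x - r) + r                            ∎
      where
      open ≡-Reasoning
      split : ∀ a b c m → a - (b + c * m) ≡ (a - b) + (- c) * m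
      split = solve-∀
      cancel : ∀ a b c m → (a + (- c) * m) + (b + c * m) ≡ a + b
      cancel = solve-∀

    shift-eval : ∀ (π : Perm n) r {i} t → i ℕ.< n →
      shift (+ r) (⊕ π) (+ suc (i ℕ.+ r) + t * + n) ≡ + suc (val π i ℕ.+ r) + t * + n
    shift-eval π r {i} t i<n = begin
      (⊕ π) (+ suc (i ℕ.+ r) + t * + n - + r) + + r  ≡⟨ cong (λ y → (⊕ π) y + + r) (unshift (+ i) (+ r) (t * + n)) ⟩
      (⊕ π) (+ suc i + t * + n) + + r                ≡⟨ cong (_+ + r) (⊕-eval π t i<n) ⟩
      + suc (val π i) + t * + n + + r                ≡⟨ reshift (+ val π i) (+ r) (t * + n) ⟩
      + suc (val π i ℕ.+ r) + t * + n                ∎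
      where
      open ≡-Reasoning
      unshift : ∀ I R T → + 1 + I + R + T - R ≡ + 1 + I + T
      unshift = solve-∀
      reshift : ∀ V R T → + 1 + V + T + R ≡ + 1 + V + R + T
      reshift = solve-∀

  module _ {p q n} .{{_ : NonZero n}} {π π′ : Perm n} {β : Perm p} {α : Perm q}
           (s : IsSum π β α) (s′ : IsSum π′ α β) where

    private
      n≡p+q : + n ≡ + p + + q
      n≡p+q = cong +_ (sym (proj₁ s))

      wrap : ∀ {N} B t → N ≡ + p + + q → + 1 + B + t * N ≡ + 1 + + q + B + (t - + 1) * N + + p
      wrap B t refl = ring (+ p) (+ q) B t
        where
        ring : ∀ P Q B T → + 1 + B + T * (P + Q) ≡ + 1 + Q + B + (T - + 1) * (P + Q) + P
        ring = solve-∀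

      unwrap : ∀ {N} I t → N ≡ + p + + q → + 1 + + q + I + (t - + 1) * N ≡ + 1 + I + t * N - + p
      unwrap I t refl = ring (+ p) (+ q) I t
        where
        ring : ∀ P Q I T → + 1 + Q + I + (T - + 1) * (P + Q) ≡ + 1 + I + T * (P + Q) - P
        ring = solve-∀

      ⊕-rotate-β : ∀ {i} t → i ℕ.< p → (⊕ π) (+ suc i + t * + n) ≡ (⊕ π′) ((+ suc i + t * + n) - + p) + + p
      ⊕-rotate-β {i} t i<p = begin
        (⊕ π) (+ suc i + t * + n)                         ≡⟨ ⊕-eval π t i<n ⟩
        + suc (val π i) + t * + n                         ≡⟨ cong (λ v → + suc v + t * + n) (IsSum-left s i<p) ⟩
        + suc (val β i) + t * + n                         ≡⟨ wrap (+ val β i) t n≡p+q ⟩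
        + suc (q ℕ.+ val β i) + (t - + 1) * + n + + p     ≡⟨ cong (λ v → + suc v + (t - + 1) * + n + + p) (IsSum-right′ s′ i<p) ⟨
        + suc (val π′ (q ℕ.+ i)) + (t - + 1) * + n + + p  ≡⟨ cong (_+ + p) (⊕-eval π′ (t - + 1) (IsSum-+< {ρ = π′} s′ i<p)) ⟨
        (⊕ π′) (+ suc (q ℕ.+ i) + (t - + 1) * + n) + + p  ≡⟨ cong (λ y → (⊕ π′) y + + p) (unwrap (+ i) t n≡p+q) ⟩
        (⊕ π′) ((+ suc i + t * + n) - + p) + + p          ∎
        where
        open ≡-Reasoning
        i<n = ℕ.<-≤-trans i<p (IsSum-≤ {ρ = π} s)

      ⊕-rotate-α : ∀ {i} t → p ℕ.≤ i → i ℕ.< n → (⊕ π) (+ suc i + t * + n) ≡ (⊕ π′) ((+ suc i + t * + n) - + p) + + p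
      ⊕-rotate-α {i} t p≤i i<n = begin
        (⊕ π) (+ suc i + t * + n)                         ≡⟨ ⊕-eval π t i<n ⟩
        + suc (val π i) + t * + n                         ≡⟨ cong (λ v → + suc v + t * + n) (IsSum-right s p≤i i<n) ⟩
        + suc (p ℕ.+ val α i′) + t * + n                  ≡⟨ move (+ p) (+ val α i′) (t * + n) ⟩
        + suc (val α i′) + t * + n + + p                  ≡⟨ cong (λ v → + suc v + t * + n + + p) (IsSum-left s′ i′<q) ⟨
        + suc (val π′ i′) + t * + n + + p                 ≡⟨ cong (_+ + p) (⊕-eval π′ t (ℕ.≤-<-trans (ℕ.m∸n≤m i p) i<n)) ⟨
        (⊕ π′) (+ suc i′ + t * + n) + + p                 ≡⟨ cong (λ y → (⊕ π′) y + + p) (move′ (+ p) (+ i′) (t * + n)) ⟩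
        (⊕ π′) ((+ suc (p ℕ.+ i′) + t * + n) - + p) + + p ≡⟨ cong (λ j → (⊕ π′) ((+ suc j + t * + n) - + p) + + p) (ℕ.m+[n∸m]≡n p≤i) ⟩
        (⊕ π′) ((+ suc i + t * + n) - + p) + + p          ∎
        where
        open ≡-Reasoning
        i′ = i ℕ.∸ p
        i′<q = <+⇒∸< p≤i (subst (i ℕ.<_) (sym (proj₁ s)) i<n)
        move : ∀ P A T → + 1 + P + A + T ≡ (+ 1 + A + T) + P
        move = solve-∀
        move′ : ∀ P I T → + 1 + I + T ≡ (+ 1 + P + I + T) - P
        move′ = solve-∀

    ⊕-rotate : ∀ x → (⊕ π) x ≡ (⊕ π′) (x - + p) + + p
    ⊕-rotate x with euclid x
    ... | i , t , i<n , refl with i ℕ.<? p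
    ... | yes i<p = ⊕-rotate-β t i<p
    ... | no i≮p = ⊕-rotate-α t (ℕ.≮⇒≥ i≮p) i<n

    shift-rotate : ∀ r x → shift r (⊕ π) x ≡ shift (r + + p) (⊕ π′) x
    shift-rotate r x = begin
      (⊕ π) (x - r) + r                              ≡⟨ cong (_+ r) (⊕-rotate (x - r)) ⟩
      (⊕ π′) (x - r - + p) + + p + r                 ≡⟨ cong (λ y → (⊕ π′) y + + p + r) (assoc x r (+ p)) ⟩
      (⊕ π′) (x - (r + + p)) + + p + r               ≡⟨ comm ((⊕ π′) (x - (r + + p))) r (+ p) ⟩
      (⊕ π′) (x - (r + + p)) + (r + + p)             ∎
      where
      open ≡-Reasoning
      assoc : ∀ a b c → a - b - c ≡ a - (b + c)
      assoc = solve-∀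
      comm : ∀ a b c → a + c + b ≡ a + (b + c)
      comm = solve-∀

  module _ {n} .{{_ : NonZero n}} (π ρ : Perm n) {r s} (s≤r : s ℕ.≤ r) (r<n : r ℕ.< n)
           (eq : ∀ x → shift (+ r) (⊕ π) x ≡ shift (+ s) (⊕ ρ) x) where

    private
      d = r ℕ.∸ s

      d+s≡r : d ℕ.+ s ≡ r
      d+s≡r = ℕ.m∸n+n≡m s≤r

      d≤n : d ℕ.≤ n
      d≤n = ℕ.≤-trans (ℕ.m∸n≤m r s) (ℕ.<⇒≤ r<n)

      +-swapʳ : ∀ a b c → a ℕ.+ b ℕ.+ c ≡ a ℕ.+ c ℕ.+ b
      +-swapʳ a b c = trans (ℕ.+-assoc a b c) (trans (cong (a ℕ.+_) (ℕ.+-comm b c)) (sym (ℕ.+-assoc a c b)))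

      cancel-s : ∀ {u v} → u ℕ.+ r ≡ v ℕ.+ s → u ℕ.+ d ≡ v
      cancel-s {u} {v} e = ℕ.+-cancelʳ-≡ s _ _ (begin
        u ℕ.+ d ℕ.+ s    ≡⟨ ℕ.+-assoc u d s ⟩
        u ℕ.+ (d ℕ.+ s)  ≡⟨ cong (u ℕ.+_) d+s≡r ⟩
        u ℕ.+ r          ≡⟨ e ⟩
        v ℕ.+ s          ∎)
        where open ≡-Reasoning

      values : ∀ {i y} t → i ℕ.< n → y ℕ.< n → + suc (i ℕ.+ r) + t * + n ≡ + suc (y ℕ.+ s) →
               + suc (val π i ℕ.+ r) + t * + n ≡ + suc (val ρ y ℕ.+ s)
      values {i} {y} t i<n y<n x≡ = begin
        + suc (val π i ℕ.+ r) + t * + n             ≡⟨ shift-eval π r t i<n ⟨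
        shift (+ r) (⊕ π) (+ suc (i ℕ.+ r) + t * + n) ≡⟨ cong (shift (+ r) (⊕ π)) x≡ ⟩
        shift (+ r) (⊕ π) (+ suc (y ℕ.+ s))        ≡⟨ eq (+ suc (y ℕ.+ s)) ⟩
        shift (+ s) (⊕ ρ) (+ suc (y ℕ.+ s))        ≡⟨ cong (shift (+ s) (⊕ ρ)) (ℤ.+-identityʳ (+ suc (y ℕ.+ s))) ⟨
        shift (+ s) (⊕ ρ) (+ suc (y ℕ.+ s) + + 0 * + n) ≡⟨ shift-eval ρ s (+ 0) y<n ⟩
        + suc (val ρ y ℕ.+ s) + + 0 * + n           ≡⟨ ℤ.+-identityʳ _ ⟩
        + suc (val ρ y ℕ.+ s)                       ∎
        where open ≡-Reasoning

    shift≡⇒val≡ : ∀ {y} → d ℕ.≤ y → y ℕ.< n → val π (y ℕ.∸ d) ℕ.+ d ≡ val ρ y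
    shift≡⇒val≡ {y} d≤y y<n = cancel-s (ℕ.suc-injective (ℤ.+-injective
      (trans (sym (ℤ.+-identityʳ _)) (values (+ 0) (ℕ.≤-<-trans (ℕ.m∸n≤m y d) y<n) y<n
        (trans (ℤ.+-identityʳ _) (cong (λ j → + suc j) i+r≡y+s))))))
      where
      i+r≡y+s : y ℕ.∸ d ℕ.+ r ≡ y ℕ.+ s
      i+r≡y+s = begin
        y ℕ.∸ d ℕ.+ r          ≡⟨ cong (y ℕ.∸ d ℕ.+_) d+s≡r ⟨
        y ℕ.∸ d ℕ.+ (d ℕ.+ s)  ≡⟨ ℕ.+-assoc (y ℕ.∸ d) d s ⟨
        y ℕ.∸ d ℕ.+ d ℕ.+ s    ≡⟨ cong (ℕ._+ s) (ℕ.m∸n+n≡m d≤y) ⟩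
        y ℕ.+ s                ∎
        where open ≡-Reasoning

    shift≡⇒val≡-wrapped : ∀ {y} → y ℕ.< d → val π (y ℕ.+ n ℕ.∸ d) ℕ.+ d ≡ val ρ y ℕ.+ n
    shift≡⇒val≡-wrapped {y} y<d = cancel-s (ℕ.suc-injective (ℤ.+-injective (begin
      + suc (val π i ℕ.+ r)                        ≡⟨ unwrap (+ suc (val π i ℕ.+ r)) (+ n) ⟩
      + suc (val π i ℕ.+ r) + -[1+ 0 ] * + n + + n  ≡⟨ cong (_+ + n) (values -[1+ 0 ] i<n y<n x≡) ⟩
      + suc (val ρ y ℕ.+ s ℕ.+ n)                  ≡⟨ cong (λ j → + suc j) (+-swapʳ (val ρ y) s n) ⟩
      + suc (val ρ y ℕ.+ n ℕ.+ s)                  ∎)))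
      where
      open ≡-Reasoning
      i = y ℕ.+ n ℕ.∸ d
      y<n = ℕ.<-≤-trans y<d d≤n
      i+d≡y+n : i ℕ.+ d ≡ y ℕ.+ n
      i+d≡y+n = ℕ.m∸n+n≡m (ℕ.≤-trans d≤n (ℕ.m≤n+m n y))
      i<n : i ℕ.< n
      i<n = ℕ.+-cancelʳ-< d i n (subst₂ ℕ._<_ (sym i+d≡y+n) (ℕ.+-comm d n) (ℕ.+-monoˡ-< n y<d))
      i+r≡y+s+n : i ℕ.+ r ≡ y ℕ.+ s ℕ.+ n
      i+r≡y+s+n = begin
        i ℕ.+ r          ≡⟨ cong (i ℕ.+_) d+s≡r ⟨
        i ℕ.+ (d ℕ.+ s)  ≡⟨ ℕ.+-assoc i d s ⟨
        i ℕ.+ d ℕ.+ s    ≡⟨ cong (ℕ._+ s) i+d≡y+n ⟩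
        y ℕ.+ n ℕ.+ s    ≡⟨ +-swapʳ y n s ⟩
        y ℕ.+ s ℕ.+ n    ∎
      x≡ : + suc (i ℕ.+ r) + -[1+ 0 ] * + n ≡ + suc (y ℕ.+ s)
      x≡ = trans (cong (λ j → + suc j + -[1+ 0 ] * + n) i+r≡y+s+n) (dropN (+ (y ℕ.+ s)) (+ n))
        where
        dropN : ∀ A M → + 1 + A + M + -[1+ 0 ] * M ≡ + 1 + A
        dropN = solve-∀
      unwrap : ∀ A M → A ≡ A + -[1+ 0 ] * M + M
      unwrap = solve-∀

    shift≡⇒SplitsAt : SplitsAt π (n ℕ.∸ d)
    shift≡⇒SplitsAt {i} i<n = below , above
      where
      below : i ℕ.< n ℕ.∸ d → val π i ℕ.< n ℕ.∸ d
      below i<n∸d = ℕ.m+n≤o⇒m≤o∸n (suc (val π i)) (subst (ℕ._< n) (sym π+d≡ρ) (val< ρ i+d<n))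
        where
        i+d<n = subst (i ℕ.+ d ℕ.<_) (ℕ.m∸n+n≡m d≤n) (ℕ.+-monoˡ-< d i<n∸d)
        π+d≡ρ : val π i ℕ.+ d ≡ val ρ (i ℕ.+ d)
        π+d≡ρ = trans (cong (λ j → val π j ℕ.+ d) (sym (ℕ.m+n∸n≡m i d)))
                      (shift≡⇒val≡ (ℕ.m≤n+m d i) i+d<n)
      above : n ℕ.∸ d ℕ.≤ i → n ℕ.∸ d ℕ.≤ val π i
      above n∸d≤i = ℕ.m≤n+o⇒m∸n≤o n d (subst (n ℕ.≤_) (trans (sym π+d≡ρ) (ℕ.+-comm (val π i) d))
                                            (ℕ.m≤n+m n (val ρ y)))
        where
        n≤i+d = subst (ℕ._≤ i ℕ.+ d) (ℕ.m∸n+n≡m d≤n) (ℕ.+-monoˡ-≤ d n∸d≤i)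
        y = i ℕ.+ d ℕ.∸ n
        y<d : y ℕ.< d
        y<d = <+⇒∸< n≤i+d (ℕ.+-monoˡ-< d i<n)
        π+d≡ρ : val π i ℕ.+ d ≡ val ρ y ℕ.+ n
        π+d≡ρ = trans (cong (λ j → val π j ℕ.+ d)
                        (sym (trans (cong (ℕ._∸ d) (ℕ.m∸n+n≡m n≤i+d)) (ℕ.m+n∸n≡m i d))))
                      (shift≡⇒val≡-wrapped y<d)

  module _ {n} .{{_ : NonZero n}} (π ρ : Perm n) where

    shift≡⇒≈ᵥ : ∀ {r} → r ℕ.< n → (∀ x → shift (+ r) (⊕ π) x ≡ shift (+ r) (⊕ ρ) x) → π ≈ᵥ ρ
    shift≡⇒≈ᵥ {r} r<n eq {y} y<n = begin
      val π y                        ≡⟨ ℕ.+-identityʳ (val π y) ⟨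
      val π (y ℕ.∸ 0) ℕ.+ 0          ≡⟨ cong (λ e → val π (y ℕ.∸ e) ℕ.+ e) (ℕ.n∸n≡0 r) ⟨
      val π (y ℕ.∸ (r ℕ.∸ r)) ℕ.+ (r ℕ.∸ r) ≡⟨ shift≡⇒val≡ π ρ ℕ.≤-refl r<n eq r∸r≤y y<n ⟩
      val ρ y                        ∎
      where
      open ≡-Reasoning
      r∸r≤y = subst (ℕ._≤ y) (sym (ℕ.n∸n≡0 r)) ℕ.z≤n

    shift-⊕-cong : π ≈ₚ ρ → ∀ r x → shift r (⊕ π) x ≡ shift r (⊕ ρ) x
    shift-⊕-cong eq r x = cong (λ v → + suc (toℕ v) + ((x - r - + 1) /ℕ n) * + n + r) (eq _)

open Permutation
open PeriodicExtension

import Level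
open import Level using (Level)
open import Data.Nat using (ℕ; zero; suc; _+_; _*_; _∸_; _⊔_; _≤_; _<_; z≤n; s≤s; z<s; _≤?_)
open import Data.Nat.Properties
open import Data.Nat.Induction using (<-wellFounded)
open import Data.Nat.ListAction using (sum)
open import Data.Integer as ℤ using (ℤ; +_)
import Data.Integer.Properties as ℤ
open import Data.Integer.DivMod using (_/ℕ_; _%ℕ_; n%ℕd<d; a≡a%ℕn+[a/ℕn]*n)
open import Data.List using (map; applyUpTo)
open import Data.Fin using (Fin; toℕ; fromℕ<; splitAt; join; remQuot; combine)
import Data.Fin.Properties as Finₚ
open import Data.Product using (Σ; ∃-syntax; _×_; _,_; proj₁; proj₂; uncurry)
open import Data.Sum using (_⊎_; inj₁; inj₂)
open import Data.Empty using (⊥-elim)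
open import Function using (_∘_)
open import Induction.WellFounded using (Acc; acc)
open import Relation.Binary.Core using (Rel)
open import Relation.Binary.Definitions using (Symmetric; Transitive; tri<; tri≈; tri>)
open import Relation.Nullary using (¬_; yes; no)
open import Relation.Binary.PropositionalEquality

∑[<_] : ℕ → (ℕ → ℕ) → ℕ
∑[< zero ] G = 0
∑[< suc n ] G = G 0 + ∑[< n ] (G ∘ suc)

sum-map-applyUpTo : ∀ n (h f : ℕ → ℕ) → sum (map h (applyUpTo f n)) ≡ ∑[< n ] (h ∘ f)
sum-map-applyUpTo zero h f = refl
sum-map-applyUpTo (suc n) h f = cong (_+_ (h (f 0))) (sum-map-applyUpTo n h (f ∘ suc))

∑[<]-mono-≤ : ∀ n {G H} → (∀ {i} → i < n → G i ≤ H i) → ∑[< n ] G ≤ ∑[< n ] H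
∑[<]-mono-≤ zero G≤H = ≤-refl
∑[<]-mono-≤ (suc n) G≤H = +-mono-≤ (G≤H (s≤s z≤n)) (∑[<]-mono-≤ n (G≤H ∘ s≤s))

term≤∑[<] : ∀ {n} G {i} → i < n → G i ≤ ∑[< n ] G
term≤∑[<] G {zero} (s≤s _) = m≤m+n (G 0) _
term≤∑[<] G {suc i} (s≤s i<n) = ≤-trans (term≤∑[<] (G ∘ suc) i<n) (m≤n+m _ (G 0))

∑[<]-*-distribˡ : ∀ n c G → ∑[< n ] (λ i → c * G i) ≡ c * ∑[< n ] G
∑[<]-*-distribˡ zero c G = sym (*-zeroʳ c)
∑[<]-*-distribˡ (suc n) c G =
  trans (cong (_+_ (c * G 0)) (∑[<]-*-distribˡ n c (G ∘ suc))) (sym (*-distribˡ-+ c (G 0) _))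

module _ {a r} {A : Set a} (_≈_ : Rel A r) where

  JointlyInjective : ∀ n (G : ℕ → ℕ) → (∀ i → i < n → Fin (G i) → A) → Set r
  JointlyInjective n G E = ∀ {i i′} (i<n : i < n) (i′<n : i′ < n) x x′ →
    E i i<n x ≈ E i′ i′<n x′ → i ≡ i′ × toℕ x ≡ toℕ x′

  private
    Enumerates : ∀ n G → (∀ i → i < n → Fin (G i) → A) → (Fin (∑[< n ] G) → A) → Set (a Level.⊔ r)
    Enumerates n G E e =
      (∀ z z′ → e z ≈ e z′ → z ≡ z′) ×
      (∀ i (i<n : i < n) x → ∃[ z ] e z ≡ E i i<n x) ×
      (∀ z → ∃[ i ] Σ (i < n) λ i<n → ∃[ x ] e z ≡ E i i<n x)

    enumerate : ∀ n G E → JointlyInjective n G E → Σ (Fin (∑[< n ] G) → A) (Enumerates n G E)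
    enumerate zero G E inj = (λ ()) , (λ ()) , (λ _ ()) , λ ()
    enumerate (suc n) G E inj = e , e-injective , e-hits , e-covers
      where
      E′ = λ i i<n → E (suc i) (s≤s i<n)
      inj′ : JointlyInjective n (G ∘ suc) E′
      inj′ i<n i′<n x x′ ≈ with inj (s≤s i<n) (s≤s i′<n) x x′ ≈
      ... | i≡i′ , x≡x′ = suc-injective i≡i′ , x≡x′
      rec = enumerate n (G ∘ suc) E′ inj′
      e′ = proj₁ rec
      e′-injective = proj₁ (proj₂ rec)
      e′-hits = proj₁ (proj₂ (proj₂ rec))
      e′-covers = proj₂ (proj₂ (proj₂ rec))
      F : Fin (G 0) ⊎ Fin (∑[< n ] (G ∘ suc)) → A
      F (inj₁ x) = E 0 (s≤s z≤n) x
      F (inj₂ w) = e′ w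
      e = F ∘ splitAt (G 0)
      F-injective : ∀ u u′ → F u ≈ F u′ → u ≡ u′
      F-injective (inj₁ x) (inj₁ x′) ≈ = cong inj₁ (Finₚ.toℕ-injective (proj₂ (inj _ _ x x′ ≈)))
      F-injective (inj₁ x) (inj₂ w′) ≈ with e′-covers w′
      ... | i , i<n , x′ , e′w′≡ with inj _ _ x x′ (subst (E 0 _ x ≈_) e′w′≡ ≈)
      ... | () , _
      F-injective (inj₂ w) (inj₁ x′) ≈ with e′-covers w
      ... | i , i<n , x , e′w≡ with inj _ _ x x′ (subst (_≈ E 0 _ x′) e′w≡ ≈)
      ... | () , _
      F-injective (inj₂ w) (inj₂ w′) ≈ = cong inj₂ (e′-injective w w′ ≈)
      e-injective : ∀ z z′ → e z ≈ e z′ → z ≡ z′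
      e-injective z z′ ≈ = trans (sym (Finₚ.join-splitAt (G 0) _ z))
        (trans (cong (join (G 0) _) (F-injective (splitAt (G 0) z) (splitAt (G 0) z′) ≈))
               (Finₚ.join-splitAt (G 0) _ z′))
      e-hits : ∀ i (i<n : i < suc n) x → ∃[ z ] e z ≡ E i i<n x
      e-hits zero (s≤s z≤n) x = join (G 0) _ (inj₁ x) , cong F (Finₚ.splitAt-join (G 0) _ (inj₁ x))
      e-hits (suc i) (s≤s i<n) x with e′-hits i i<n x
      ... | w , e′w≡ = join (G 0) _ (inj₂ w) , trans (cong F (Finₚ.splitAt-join (G 0) _ (inj₂ w))) e′w≡
      e-covers : ∀ z → ∃[ i ] Σ (i < suc n) λ i<n → ∃[ x ] e z ≡ E i i<n x
      e-covers z with splitAt (G 0) z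
      ... | inj₁ x = 0 , s≤s z≤n , x , refl
      ... | inj₂ w with e′-covers w
      ... | i , i<n , x , e′w≡ = suc i , s≤s i<n , x , e′w≡

  HasCard-∑ : ∀ n G (E : ∀ i → i < n → Fin (G i) → A) → JointlyInjective n G E →
    (∀ y → ∃[ i ] Σ (i < n) λ i<n → ∃[ x ] E i i<n x ≈ y) → HasCard A _≈_ (∑[< n ] G)
  HasCard-∑ n G E inj onto with enumerate n G E inj
  ... | e , e-injective , e-hits , _ = e , e-injective , λ y →
    let (i , i<n , x , Ex≈y) = onto y
        (z , ez≡Ex) = e-hits i i<n x
    in z , subst (_≈ y) (sym ez≡Ex) Ex≈y

  module _ (≈-sym : Symmetric _≈_) (≈-trans : Transitive _≈_) where

    HasCard-≤ : ∀ {m m′} → HasCard A _≈_ m → HasCard A _≈_ m′ → m′ ≤ m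
    HasCard-≤ (e , _ , e-onto) (e′ , e′-inj , _) = Finₚ.injective⇒≤ h-injective
      where
      h = λ i → proj₁ (e-onto (e′ i))
      h-injective : ∀ {i j} → h i ≡ h j → i ≡ j
      h-injective {i} {j} hi≡hj = e′-inj i j (≈-trans (≈-sym (proj₂ (e-onto (e′ i))))
        (subst (λ z → e z ≈ e′ j) (sym hi≡hj) (proj₂ (e-onto (e′ j)))))

    HasCard-unique : ∀ {m m′} → HasCard A _≈_ m → HasCard A _≈_ m′ → m ≡ m′
    HasCard-unique c c′ = ≤-antisym (HasCard-≤ c′ c) (HasCard-≤ c c′)

remQuot-injective : ∀ {m} k {x y : Fin (m * k)} → remQuot {m} k x ≡ remQuot k y → x ≡ y
remQuot-injective {m} k {x} {y} eq = trans (sym (Finₚ.combine-remQuot {m} k x))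
  (trans (cong (uncurry combine) eq) (Finₚ.combine-remQuot {m} k y))

decoded-injective : ∀ {G : ℕ → ℕ} (F : ℕ → Set) (decode : ∀ i → Fin (G i) → F i) →
  (∀ {i} {x x′ : Fin (G i)} → decode i x ≡ decode i x′ → x ≡ x′) →
  ∀ {i i′} {x : Fin (G i)} {x′ : Fin (G i′)} →
  Σ (i ≡ i′) (λ i≡i′ → subst F i≡i′ (decode i x) ≡ decode i′ x′) → i ≡ i′ × toℕ x ≡ toℕ x′
decoded-injective F decode decode-injective (refl , eq) = refl , cong toℕ (decode-injective eq)

module Decomposition {ℓ} (C : PermSet ℓ) (closed : IsPermClass C) (sumClosed : IsSumClosed C)
  (f g : ℕ → ℕ) (f0≡1 : f 0 ≡ 1)
  (card-C : ∀ n → HasCard (Cₙ C (suc n)) (≈C C) (f (suc n)))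
  (card-Cind : ∀ n → HasCard (Cindₙ C (suc n)) (≈I C) (g (suc n))) (m : ℕ) where

  n : ℕ
  n = suc m

  -- Both relations ignore the membership proofs in their arguments, so the implicit arguments of
  -- these lemmas can never be inferred and are passed explicitly where they are used.
  private
    ≈C-sym : Symmetric (≈C C {n})
    ≈C-sym x≈y i = sym (x≈y i)

    ≈C-trans : Transitive (≈C C {n})
    ≈C-trans x≈y y≈z i = trans (x≈y i) (y≈z i)

    ⊕≈-sym : Symmetric (⊕≈ C n)
    ⊕≈-sym x≈y X = sym (x≈y X)

    ⊕≈-trans : Transitive (⊕≈ C n)
    ⊕≈-trans x≈y y≈z X = trans (x≈y X) (y≈z X)

  cardC : ∀ k → C εₚ → HasCard (Cₙ C k) (≈C C) (f k)
  cardC zero ε∈C = subst (HasCard (Cₙ C 0) (≈C C)) (sym f0≡1)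
    ((λ _ → εₚ , ε∈C) , (λ { Fin.zero Fin.zero _ → refl }) , λ _ → Fin.zero , λ ())
  cardC (suc k) _ = card-C k

  -- An index i < n stands for a last block of size k = i + 1, followed by a rest of size n − k.
  α : ∀ i → Fin (g (suc i)) → Perm (suc i)
  α i a = proj₁ (proj₁ (card-Cind i) a)

  α-∈ : ∀ i a → C (α i a)
  α-∈ i a = proj₁ (proj₂ (proj₁ (card-Cind i) a))

  α-indecomposable : ∀ i a → Indecomposable (α i a)
  α-indecomposable i a = proj₂ (proj₂ (proj₁ (card-Cind i) a))

  card-β : ∀ i → Fin (g (suc i)) → HasCard (Cₙ C (n ∸ suc i)) (≈C C) (f (n ∸ suc i))
  card-β i a = cardC (n ∸ suc i) (empty-∈ closed (α-∈ i a))

  β : ∀ i a → Fin (f (n ∸ suc i)) → Perm (n ∸ suc i)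
  β i a b = proj₁ (proj₁ (card-β i a) b)

  glue : ∀ {i} → i < n → Fin (g (suc i)) → Fin (f (n ∸ suc i)) → Perm n
  glue {i} i<n a b = directSum (m∸n+n≡m i<n) (β i a b) (α i a)

  glue-IsSum : ∀ {i} (i<n : i < n) a b → IsSum (glue i<n a b) (β i a b) (α i a)
  glue-IsSum {i} i<n a b = directSum-IsSum (m∸n+n≡m i<n) (β i a b) (α i a)

  glue-∈ : ∀ {i} (i<n : i < n) a b → C (glue i<n a b)
  glue-∈ {i} i<n a b = sumClosed _ _ _ (proj₂ (proj₁ (card-β i a) b)) (α-∈ i a) (glue-IsSum i<n a b)

  glue-size-injective : ∀ {i i′} (i<n : i < n) (i′<n : i′ < n) a a′ b b′ →
    glue i<n a b ≈ᵥ glue i′<n a′ b′ → i ≡ i′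
  glue-size-injective i<n i′<n a a′ b b′ eq = suc-injective (∸-cancelˡ-≡ i<n i′<n
    (lastBlock-unique {π = glue i<n a b} (glue-IsSum i<n a b) (α-indecomposable _ a)
      (IsSum-resp-≈ᵥ {ρ′ = glue i<n a b} (λ j<n → sym (eq j<n)) (glue-IsSum i′<n a′ b′))
      (α-indecomposable _ a′)))

  glue-injective : ∀ {i} (i<n i<n′ : i < n) a a′ b b′ → glue i<n a b ≈ᵥ glue i<n′ a′ b′ → a ≡ a′ × b ≡ b′
  glue-injective {i} i<n i<n′ a a′ b b′ eq = a≡a′ , b≡b′ a≡a′ s′
    where
    s = glue-IsSum i<n a b
    s′ : IsSum (glue i<n a b) (β i a′ b′) (α i a′)
    s′ = IsSum-resp-≈ᵥ (λ j<n → sym (eq j<n)) (glue-IsSum i<n′ a′ b′)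
    a≡a′ : a ≡ a′
    a≡a′ = proj₁ (proj₂ (card-Cind i)) a a′ (≈ᵥ⇒≈ₚ (IsSum-injectiveʳ {ρ = glue i<n a b} s s′))
    b≡b′ : ∀ {a′} → a ≡ a′ → IsSum (glue i<n a b) (β i a′ b′) (α i a′) → b ≡ b′
    b≡b′ refl s′ = proj₁ (proj₂ (card-β i a)) b b′ (≈ᵥ⇒≈ₚ (IsSum-injectiveˡ {ρ = glue i<n a b} s s′))

  private
    IsSum-substˡ : ∀ {p q k} {π : Perm n} (e : p ≡ q) (x : Cₙ C p) {τ : Perm k} →
      IsSum π (proj₁ x) τ → IsSum π (proj₁ (subst (Cₙ C) e x)) τ
    IsSum-substˡ refl x s = s

  glue-onto : (π : Perm n) → C π → (L : LastBlock π) → let open LastBlock L in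
    ∃[ a ] ∃[ b ] glue size<n a b ≈ᵥ π
  glue-onto π π∈C L = a , b , IsSum-cong (glue-IsSum size<n a b) rest′-IsSum (≈ₚ⇒≈ᵥ b≈) (≈ₚ⇒≈ᵥ a≈)
    where
    open LastBlock L
    found-a = proj₂ (proj₂ (card-Cind size)) (block , summandʳ-∈ closed isSum π∈C , indecomposable)
    a = proj₁ found-a
    a≈ = proj₂ found-a
    start≡ : start ≡ n ∸ suc size
    start≡ = trans (sym (m+n∸n≡m start (suc size))) (cong (_∸ suc size) (proj₁ isSum))
    rest∈C = summandˡ-∈ closed {ρ = π} isSum π∈C
    rest′ = subst (Cₙ C) start≡ (rest , rest∈C)
    rest′-IsSum : IsSum π (proj₁ rest′) block
    rest′-IsSum = IsSum-substˡ {π = π} start≡ (rest , rest∈C) isSum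
    found-b = proj₂ (proj₂ (card-β size a)) rest′
    b = proj₁ found-b
    b≈ = proj₂ found-b

  Blocks : ℕ → Set
  Blocks i = Fin (g (suc i)) × Fin (f (n ∸ suc i))

  glued : ∀ {i} → i < n → Blocks i → Cₙ C n
  glued i<n (a , b) = glue i<n a b , glue-∈ i<n a b

  gf : ℕ → ℕ
  gf i = g (suc i) * f (n ∸ suc i)

  enumC : ∀ i → i < n → Fin (gf i) → Cₙ C n
  enumC i i<n = glued i<n ∘ remQuot (f (n ∸ suc i))

  glued-injective : ∀ {i i′} (i<n : i < n) (i′<n : i′ < n) u u′ →
    ≈C C (glued i<n u) (glued i′<n u′) → Σ (i ≡ i′) λ i≡i′ → subst Blocks i≡i′ u ≡ u′
  glued-injective {i} i<n i′<n (a , b) (a′ , b′) eq =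
    sameSize (glue-size-injective i<n i′<n a a′ b b′ (≈ₚ⇒≈ᵥ eq)) i′<n a′ b′ eq
    where
    sameSize : ∀ {i′} (i≡i′ : i ≡ i′) (i′<n : i′ < n) a′ b′ → ≈C C (glued i<n (a , b)) (glued i′<n (a′ , b′)) →
      Σ (i ≡ i′) λ i≡i′ → subst Blocks i≡i′ (a , b) ≡ (a′ , b′)
    sameSize refl i′<n a′ b′ eq = refl , uncurry (cong₂ _,_) (glue-injective i<n i′<n a a′ b b′ (≈ₚ⇒≈ᵥ eq))

  enumC-injective : JointlyInjective (≈C C) n gf enumC
  enumC-injective i<n i′<n x x′ eq = decoded-injective Blocks (λ i → remQuot (f (n ∸ suc i)))
    (remQuot-injective _) (glued-injective i<n i′<n (remQuot _ x) (remQuot _ x′) eq)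

  enumC-onto : ∀ y → ∃[ i ] Σ (i < n) λ i<n → ∃[ x ] ≈C C (enumC i i<n x) y
  enumC-onto (π , π∈C) = size , size<n , combine a b ,
    subst (λ ab → proj₁ (glued size<n ab) ≈ₚ π) (sym (Finₚ.remQuot-combine a b)) (≈ᵥ⇒≈ₚ glue≈π)
    where
    L = lastBlock π
    open LastBlock L
    a = proj₁ (glue-onto π π∈C L)
    b = proj₁ (proj₂ (glue-onto π π∈C L))
    glue≈π = proj₂ (proj₂ (glue-onto π π∈C L))

  card-enumC : HasCard (Cₙ C n) (≈C C) (∑[< n ] gf)
  card-enumC = HasCard-∑ (≈C C) n gf enumC enumC-injective enumC-onto

  f≡∑ : f n ≡ ∑[< n ] gf
  f≡∑ = HasCard-unique (≈C C) (λ {x y} → ≈C-sym {x} {y}) (λ {x y z} → ≈C-trans {x} {y} {z}) (card-C m) card-enumC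

  shift-beyond-block : ∀ {i} (i<n : i < n) a b {r s} (ρ : Perm n) → s < r → r ≤ i →
    ¬ (∀ x → shift (+ r) (⊕ (glue i<n a b)) x ≡ shift (+ s) (⊕ ρ) x)
  shift-beyond-block {i} i<n a b {r} {s} ρ s<r r≤i eq =
    splitInside-decomposes (glue-IsSum i<n a b) (α-indecomposable i a) start<split split<n
      (shift≡⇒SplitsAt (glue i<n a b) ρ (<⇒≤ s<r) (≤-<-trans r≤i i<n) eq)
    where
    start<split : n ∸ suc i < n ∸ (r ∸ s)
    start<split = ∸-monoʳ-< (s≤s (≤-trans (m∸n≤m r s) r≤i)) i<n
    split<n : n ∸ (r ∸ s) < n
    split<n = ∸-monoʳ-< (m<n⇒0<n∸m s<r) (≤-trans (m∸n≤m r s) (≤-trans r≤i (<⇒≤ i<n)))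

  kgf : ℕ → ℕ
  kgf i = suc i * g (suc i) * f (n ∸ suc i)

  decode : ∀ i → Fin (kgf i) → Fin (suc i) × Blocks i
  decode i x =
    let (u , b) = remQuot {suc i * g (suc i)} (f (n ∸ suc i)) x
        (j , a) = remQuot {suc i} (g (suc i)) u
    in j , a , b

  decode-combine : ∀ {i} j a b → decode i (combine (combine j a) b) ≡ (j , a , b)
  decode-combine {i} j a b = trans
    (cong (λ (u , b) → proj₁ (remQuot (g (suc i)) u) , proj₂ (remQuot (g (suc i)) u) , b)
          (Finₚ.remQuot-combine (combine j a) b))
    (cong (λ (j , a) → j , a , b) (Finₚ.remQuot-combine j a))

  decode-injective : ∀ {i} {x x′ : Fin (kgf i)} → decode i x ≡ decode i x′ → x ≡ x′
  decode-injective {i} {x} {x′} eq = remQuot-injective (f (n ∸ suc i)) (cong₂ _,_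
    (remQuot-injective (g (suc i)) (cong₂ _,_ (cong proj₁ eq) (cong (proj₁ ∘ proj₂) eq)))
    (cong (proj₂ ∘ proj₂) eq))

  shifted : ∀ {i} → i < n → Fin (suc i) × Blocks i → ⊕Cₙ C n
  shifted i<n (j , a , b) = glued i<n (a , b) , + toℕ j

  enum⊕C : ∀ i → i < n → Fin (kgf i) → ⊕Cₙ C n
  enum⊕C i i<n = shifted i<n ∘ decode i

  shift-amount-unique : ∀ {i i′} (i<n : i < n) (i′<n : i′ < n) j j′ a a′ b b′ →
    ⊕≈ C n (shifted i<n (j , a , b)) (shifted i′<n (j′ , a′ , b′)) → toℕ j ≡ toℕ j′
  shift-amount-unique i<n i′<n j j′ a a′ b b′ eq with <-cmp (toℕ j) (toℕ j′)
  ... | tri≈ _ j≡j′ _ = j≡j′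
  ... | tri< j<j′ _ _ =
    ⊥-elim (shift-beyond-block i′<n a′ b′ (glue i<n a b) j<j′ (≤-pred (Finₚ.toℕ<n j′)) (λ X → sym (eq X)))
  ... | tri> _ _ j′<j =
    ⊥-elim (shift-beyond-block i<n a b (glue i′<n a′ b′) j′<j (≤-pred (Finₚ.toℕ<n j)) eq)

  shifted-glue≈ : ∀ {i i′} (i<n : i < n) (i′<n : i′ < n) j j′ a a′ b b′ →
    ⊕≈ C n (shifted i<n (j , a , b)) (shifted i′<n (j′ , a′ , b′)) → glue i<n a b ≈ᵥ glue i′<n a′ b′
  shifted-glue≈ i<n i′<n j j′ a a′ b b′ eq =
    shift≡⇒≈ᵥ (glue i<n a b) (glue i′<n a′ b′) (<-≤-trans (Finₚ.toℕ<n j) i<n) λ X →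
      trans (eq X) (cong (λ r → shift (+ r) (⊕ (glue i′<n a′ b′)) X) (sym j≡j′))
    where j≡j′ = shift-amount-unique i<n i′<n j j′ a a′ b b′ eq

  shifted-injective : ∀ {i i′} (i<n : i < n) (i′<n : i′ < n) u u′ →
    ⊕≈ C n (shifted i<n u) (shifted i′<n u′) → Σ (i ≡ i′) λ i≡i′ → subst (λ k → Fin (suc k) × Blocks k) i≡i′ u ≡ u′
  shifted-injective {i} i<n i′<n (j , a , b) (j′ , a′ , b′) eq =
    withShift (glued-injective i<n i′<n (a , b) (a′ , b′) (≈ᵥ⇒≈ₚ (shifted-glue≈ i<n i′<n j j′ a a′ b b′ eq)))
              (shift-amount-unique i<n i′<n j j′ a a′ b b′ eq)
    where
    withShift : ∀ {i′} {j′ : Fin (suc i′)} {u′} → Σ (i ≡ i′) (λ i≡i′ → subst Blocks i≡i′ (a , b) ≡ u′) →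
      toℕ j ≡ toℕ j′ → Σ (i ≡ i′) λ i≡i′ → subst (λ k → Fin (suc k) × Blocks k) i≡i′ (j , a , b) ≡ (j′ , u′)
    withShift (refl , u≡u′) j≡j′ = refl , cong₂ _,_ (Finₚ.toℕ-injective j≡j′) u≡u′

  enum⊕C-injective : JointlyInjective (⊕≈ C n) n kgf enum⊕C
  enum⊕C-injective i<n i′<n x x′ eq = decoded-injective (λ k → Fin (suc k) × Blocks k) decode
    decode-injective (shifted-injective i<n i′<n (decode _ x) (decode _ x′) eq)

  Represented : (π : Perm n) → C π → ℕ → Set
  Represented π π∈C r = ∃[ i ] Σ (i < n) λ i<n → ∃[ x ] ⊕≈ C n (enum⊕C i i<n x) ((π , π∈C) , + r)

  module _ (π : Perm n) (π∈C : C π) (L : LastBlock π) where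
    open LastBlock L

    represent-within : ∀ {r} → r ≤ size → Represented π π∈C r
    represent-within {r} r≤k = size , size<n , combine (combine j a) b ,
      subst (λ u → ⊕≈ C n (shifted size<n u) ((π , π∈C) , + r)) (sym (decode-combine j a b)) λ X →
        trans (cong (λ t → shift (+ t) (⊕ (glue size<n a b)) X) (Finₚ.toℕ-fromℕ< (s≤s r≤k)))
              (shift-⊕-cong (glue size<n a b) π (≈ᵥ⇒≈ₚ glue≈π) (+ r) X)
      where
      j = fromℕ< (s≤s r≤k)
      a = proj₁ (glue-onto π π∈C L)
      b = proj₁ (proj₂ (glue-onto π π∈C L))
      glue≈π = proj₂ (proj₂ (glue-onto π π∈C L))

    represent-rotated : ∀ {r} → size < r → r < n →
      (∀ {r′} → r′ < r → (π′ : Perm n) (π′∈C : C π′) → Represented π′ π′∈C r′) → Represented π π∈C r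
    represent-rotated {r} k<r r<n represent′ =
      let (i , i<n , x , eq) = represent′ r′<r π′ π′∈C in i , i<n , x , λ X → trans (eq X) (unrotate X)
      where
      n≤r+start : n ≤ r + start
      n≤r+start = subst₂ _≤_ (proj₁ isSum) (+-comm start r) (+-monoʳ-≤ start k<r)
      r′ = r + start ∸ n
      r′<r : r′ < r
      r′<r = <+⇒∸< n≤r+start (subst (r + start <_) (+-comm r n) (+-monoʳ-< r (IsSum-< {ρ = π} isSum)))
      r′+n≡r+start : + r′ ℤ.+ + 1 ℤ.* + n ≡ + r ℤ.+ + start
      r′+n≡r+start = trans (cong (ℤ._+_ (+ r′)) (ℤ.*-identityˡ (+ n))) (cong +_ (m∸n+n≡m n≤r+start))
      π′ = directSum (trans (+-comm (suc size) start) (proj₁ isSum)) block rest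
      π′-IsSum = directSum-IsSum (trans (+-comm (suc size) start) (proj₁ isSum)) block rest
      π′∈C = sumClosed block rest π′ (summandʳ-∈ closed isSum π∈C) (summandˡ-∈ closed isSum π∈C) π′-IsSum
      unrotate : ∀ X → shift (+ r′) (⊕ π′) X ≡ shift (+ r) (⊕ π) X
      unrotate X = begin
        shift (+ r′) (⊕ π′) X                ≡⟨ shift-periodic π′ (+ r′) (+ 1) X ⟨
        shift (+ r′ ℤ.+ + 1 ℤ.* + n) (⊕ π′) X ≡⟨ cong (λ t → shift t (⊕ π′) X) r′+n≡r+start ⟩
        shift (+ r ℤ.+ + start) (⊕ π′) X     ≡⟨ shift-rotate {π = π} {π′ = π′} isSum π′-IsSum (+ r) X ⟨
        shift (+ r) (⊕ π) X                  ∎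
        where open ≡-Reasoning

  -- Rotating the last block to the front replaces the shift r by r + start − n < r.
  represent : ∀ {r} → Acc _<_ r → r < n → (π : Perm n) (π∈C : C π) → Represented π π∈C r
  represent {r} (acc smaller) r<n π π∈C with r ≤? LastBlock.size (lastBlock π)
  ... | yes r≤k = represent-within π π∈C (lastBlock π) r≤k
  ... | no r≰k = represent-rotated π π∈C (lastBlock π) (≰⇒> r≰k) r<n
    λ r′<r → represent (smaller r′<r) (<-trans r′<r r<n)

  enum⊕C-onto : ∀ y → ∃[ i ] Σ (i < n) λ i<n → ∃[ x ] ⊕≈ C n (enum⊕C i i<n x) y
  enum⊕C-onto ((π , π∈C) , r) =
    let (i , i<n , x , eq) = represent (<-wellFounded (r %ℕ n)) (n%ℕd<d r n) π π∈C
    in i , i<n , x , λ X → trans (eq X) (trans (sym (shift-periodic π (+ (r %ℕ n)) (r /ℕ n) X))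
                                          (cong (λ t → shift t (⊕ π) X) (sym (a≡a%ℕn+[a/ℕn]*n r n))))

  card-enum⊕C : HasCard (⊕Cₙ C n) (⊕≈ C n) (∑[< n ] kgf)
  card-enum⊕C = HasCard-∑ (⊕≈ C n) n kgf enum⊕C enum⊕C-injective enum⊕C-onto

  f̃≡∑ : ∀ {h} → HasCard (⊕Cₙ C n) (⊕≈ C n) h → h ≡ ∑[< n ] kgf
  f̃≡∑ card = HasCard-unique (⊕≈ C n) (λ {x y} → ⊕≈-sym {x} {y}) (λ {x y z} → ⊕≈-trans {x} {y} {z}) card card-enum⊕C

  kgf≡k*gf : ∀ i → kgf i ≡ suc i * gf i
  kgf≡k*gf i = *-assoc (suc i) (g (suc i)) (f (n ∸ suc i))


proposition2p2 : ∀ {ℓ : Level} (C : PermSet ℓ) → IsPermClass C → IsSumClosed C →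
    (f g f̃ : ℕ → ℕ) →
    f 0 ≡ 1 →
    (∀ n → HasCard (Cₙ C (suc n)) (≈C C) (f (suc n))) →
    (∀ n → HasCard (Cindₙ C (suc n)) (≈I C) (g (suc n))) →
    (∀ n → HasCard (⊕Cₙ C (suc n)) (⊕≈ C (suc n)) (f̃ (suc n))) →
    ∀ n → 1 ≤ n →
      (f̃ n ≡ ∑[1‥ n ] (λ k → k * g k * f (n ∸ k))) ×
      ((n * g n ⊔ f n ≤ f̃ n) × (f̃ n ≤ n * f n))
proposition2p2 C closed sumClosed f g f̃ f0≡1 card-C card-Cind card-⊕C (suc m) _ =
  trans f̃≡∑kgf (sym (sum-map-applyUpTo n _ suc)) , ⊔-lub n*gₙ≤f̃ₙ fₙ≤f̃ₙ , f̃ₙ≤n*fₙ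
  where
  open Decomposition C closed sumClosed f g f0≡1 card-C card-Cind m
  f̃≡∑kgf = f̃≡∑ (card-⊕C m)
  lastTerm : kgf m ≡ n * g n
  lastTerm = trans (cong (λ k → n * g n * f k) (n∸n≡0 m)) (trans (cong (n * g n *_) f0≡1) (*-identityʳ _))
  n*gₙ≤f̃ₙ : n * g n ≤ f̃ n
  n*gₙ≤f̃ₙ = subst₂ _≤_ lastTerm (sym f̃≡∑kgf) (term≤∑[<] kgf ≤-refl)
  fₙ≤f̃ₙ : f n ≤ f̃ n
  fₙ≤f̃ₙ = subst₂ _≤_ (sym f≡∑) (sym f̃≡∑kgf) (∑[<]-mono-≤ n λ {i} _ →
    subst (gf i ≤_) (sym (kgf≡k*gf i)) (m≤n*m (gf i) (suc i)))
  f̃ₙ≤n*fₙ : f̃ n ≤ n * f n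
  f̃ₙ≤n*fₙ = subst₂ _≤_ (sym f̃≡∑kgf) (trans (∑[<]-*-distribˡ n n gf) (cong (n *_) (sym f≡∑)))
    (∑[<]-mono-≤ n λ {i} i<n → subst (_≤ n * gf i) (sym (kgf≡k*gf i)) (*-monoˡ-≤ (gf i) i<n))
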